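{- Let $G$ be a finite simple graph. Then $$\alpha(G)-|\alpha_{core}(G)|\leq \tau(G)-|\tau_{core}(G)|.$$
   Context: $\alpha(G)$ denotes the maximum cardinality of a stable (independent) set of $G$, and $\tau(G)$ the minimum cardinality of a vertex cover of $G$. $\alpha_{core}(G)$ is the intersection of all stable sets of $G$ of cardinality $\alpha(G)$, and $\tau_{core}(G)$ is the intersection of all vertex covers of $G$ of cardinality $\tau(G)$. -}

module Defs where

open import Data.Nat using (ℕ; _≤_)
open import Data.Fin using (Fin)
open import Data.Fin.Subset using (Subset; _∈_; _∉_; ∣_∣)
open import Data.Product using (Σ; _×_)
open import Relation.Nullary using (¬_)
open import Relation.Binary.PropositionalEquality using (_≡_)
open import Function.Bundles using (_⇔_)
open import Level using (0ℓ; suc)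

record Graph (n : ℕ) : Set₁ where
  field
    Adj    : Fin n → Fin n → Set
    sym    : ∀ {i j} → Adj i j → Adj j i
    irrefl : ∀ {i} → ¬ Adj i i
open Graph public

module _ {n : ℕ} (G : Graph n) where

  IsStable : Subset n → Set
  IsStable S = ∀ i j → i ∈ S → j ∈ S → ¬ Adj G i j

  IsVertexCover : Subset n → Set
  IsVertexCover C = ∀ i j → Adj G i j → (i ∈ C) Data.Sum.⊎ (j ∈ C)
    where import Data.Sum

  IsAlpha : ℕ → Set
  IsAlpha a = Σ (Subset n) (λ S → IsStable S × ∣ S ∣ ≡ a)
            × (∀ S → IsStable S → ∣ S ∣ ≤ a)

  IsTau : ℕ → Set
  IsTau t = Σ (Subset n) (λ C → IsVertexCover C × ∣ C ∣ ≡ t)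
          × (∀ C → IsVertexCover C → t ≤ ∣ C ∣)

  IsMaxStable : Subset n → Set
  IsMaxStable S = IsStable S × (∀ T → IsStable T → ∣ T ∣ ≤ ∣ S ∣)

  IsMinCover : Subset n → Set
  IsMinCover C = IsVertexCover C × (∀ D → IsVertexCover D → ∣ C ∣ ≤ ∣ D ∣)

  IsAlphaCore : Subset n → Set
  IsAlphaCore K = ∀ i → (i ∈ K) ⇔ (∀ S → IsMaxStable S → i ∈ S)

  IsTauCore : Subset n → Set
  IsTauCore K = ∀ i → (i ∈ K) ⇔ (∀ C → IsMinCover C → i ∈ C)

-- Every vertex outside the α-core is missed by some maximum stable set, so the
-- α-core contains the intersection of finitely many maximum stable sets
-- S₀, …, Sₖ (constructively only up to double negation, which is harmless
-- since the goal is decidable). Their union avoids the τ-core, because the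
-- complement of a maximum stable set is a minimum vertex cover. Adding the sets
-- one at a time, |⋃ Sᵢ| + |⋂ Sᵢ| never drops below 2α: if I ⊆ U are the
-- current intersection and union and T is the next set, then (I ∖ T) ∪ (T ∩ U)
-- is stable, hence has at most |T| elements, which is exactly the inequality
-- needed. So 2α ≤ |α-core| + (n − |τ-core|), and n ≤ α + τ finishes the proof.
module Submission where

open import Defs
open import Data.Nat using (ℕ; _≤_; _∸_)
open import Data.Fin.Subset using (Subset; ∣_∣)

open import Data.Nat using (zero; suc; _+_; z≤n; s≤s⁻¹)
open import Data.Nat.Properties
open import Algebra.Properties.CommutativeSemigroup +-commutativeSemigroup using (xy∙z≈zx∙y; xy∙z≈xz∙y; xy∙z≈y∙xz)
open import Data.Fin using (Fin)
import Data.Fin as Fin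
open import Data.Fin.Subset using (_∈_; _∉_; _∩_; _∪_; ∁; _⊆_; ⋃; ⋂; Empty; inside; outside)
open import Data.Fin.Subset.Properties
  using (_∈?_; ∉⊥; drop-∷-Empty; x∈p∩q⁻; x∈p∪q⁺; x∈p∪q⁻; x∈∁p⇒x∉p; x∉p⇒x∈∁p; p⊆q⇒∣p∣≤∣q∣; ∣p∣≤n; ∣∁p∣≡n∸∣p∣; ∩-comm; ∩-identityʳ; ∪-identityʳ)
open import Data.List using (List; []; _∷_; tabulate)
open import Data.List.Relation.Unary.All as All using (All; []; _∷_)
import Data.List.Relation.Unary.All.Properties as All
open import Data.Vec using ([]; _∷_; here)
open import Data.Product using (Σ-syntax; _×_; _,_; proj₁; proj₂)
open import Data.Sum as Sum using (_⊎_; inj₁; inj₂; [_,_])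
open import Data.Empty using (⊥-elim)
open import Function using (_∘_; id)
open import Function.Bundles using (Equivalence)
open import Level using (Level)
open import Relation.Nullary using (¬_; yes; no)
open import Relation.Nullary.Negation using (¬¬-map)
open import Relation.Nullary.Decidable using (decidable-stable)
open import Relation.Binary.PropositionalEquality using (_≡_; refl; trans; cong; cong₂; subst; subst₂)
  renaming (sym to ≡-sym)

private
  variable
    n : ℕ

¬¬-Π-Fin : ∀ {ℓ : Level} m {P : Fin m → Set ℓ} → (∀ i → ¬ ¬ P i) → ¬ ¬ (∀ i → P i)
¬¬-Π-Fin zero    _   ¬∀P = ¬∀P (λ ())
¬¬-Π-Fin (suc m) ¬¬P ¬∀P = ¬¬P Fin.zero λ P₀ → ¬¬-Π-Fin m (¬¬P ∘ Fin.suc) λ Pₛ →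
  ¬∀P λ { Fin.zero → P₀ ; (Fin.suc i) → Pₛ i }

m+n≤o+p⇒m∸p≤o∸n : ∀ m n o p → m + n ≤ o + p → m ∸ p ≤ o ∸ n
m+n≤o+p⇒m∸p≤o∸n m       n o zero    le = m+n≤o⇒m≤o∸n m (subst (m + n ≤_) (+-identityʳ o) le)
m+n≤o+p⇒m∸p≤o∸n zero    n o (suc p) le = z≤n
m+n≤o+p⇒m∸p≤o∸n (suc m) n o (suc p) le =
  m+n≤o+p⇒m∸p≤o∸n m n o p (s≤s⁻¹ (subst (suc m + n ≤_) (+-suc o p) le))

∣p∣+∣∁p∣≡n : (p : Subset n) → ∣ p ∣ + ∣ ∁ p ∣ ≡ n
∣p∣+∣∁p∣≡n p = trans (cong (∣ p ∣ +_) (∣∁p∣≡n∸∣p∣ p)) (m+[n∸m]≡n (∣p∣≤n p))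

∣p∩q∣+∣p∩∁q∣≡∣p∣ : (p q : Subset n) → ∣ p ∩ q ∣ + ∣ p ∩ ∁ q ∣ ≡ ∣ p ∣
∣p∩q∣+∣p∩∁q∣≡∣p∣ []            []            = refl
∣p∩q∣+∣p∩∁q∣≡∣p∣ (inside  ∷ p) (inside  ∷ q) = cong suc (∣p∩q∣+∣p∩∁q∣≡∣p∣ p q)
∣p∩q∣+∣p∩∁q∣≡∣p∣ (inside  ∷ p) (outside ∷ q) = trans (+-suc _ _) (cong suc (∣p∩q∣+∣p∩∁q∣≡∣p∣ p q))
∣p∩q∣+∣p∩∁q∣≡∣p∣ (outside ∷ p) (_       ∷ q) = ∣p∩q∣+∣p∩∁q∣≡∣p∣ p q

∣p∪q∣+∣p∩q∣≡∣p∣+∣q∣ : (p q : Subset n) → ∣ p ∪ q ∣ + ∣ p ∩ q ∣ ≡ ∣ p ∣ + ∣ q ∣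
∣p∪q∣+∣p∩q∣≡∣p∣+∣q∣ []            []            = refl
∣p∪q∣+∣p∩q∣≡∣p∣+∣q∣ (inside  ∷ p) (inside  ∷ q) =
  cong suc (trans (+-suc _ _) (trans (cong suc (∣p∪q∣+∣p∩q∣≡∣p∣+∣q∣ p q)) (≡-sym (+-suc _ _))))
∣p∪q∣+∣p∩q∣≡∣p∣+∣q∣ (inside  ∷ p) (outside ∷ q) = cong suc (∣p∪q∣+∣p∩q∣≡∣p∣+∣q∣ p q)
∣p∪q∣+∣p∩q∣≡∣p∣+∣q∣ (outside ∷ p) (inside  ∷ q) =
  trans (cong suc (∣p∪q∣+∣p∩q∣≡∣p∣+∣q∣ p q)) (≡-sym (+-suc _ _))
∣p∪q∣+∣p∩q∣≡∣p∣+∣q∣ (outside ∷ p) (outside ∷ q) = ∣p∪q∣+∣p∩q∣≡∣p∣+∣q∣ p q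

∣p∪q∣≡∣p∣+∣q∣ : (p q : Subset n) → Empty (p ∩ q) → ∣ p ∪ q ∣ ≡ ∣ p ∣ + ∣ q ∣
∣p∪q∣≡∣p∣+∣q∣ []            []            _ = refl
∣p∪q∣≡∣p∣+∣q∣ (inside  ∷ p) (inside  ∷ q) e = ⊥-elim (e (Fin.zero , here))
∣p∪q∣≡∣p∣+∣q∣ (inside  ∷ p) (outside ∷ q) e = cong suc (∣p∪q∣≡∣p∣+∣q∣ p q (drop-∷-Empty e))
∣p∪q∣≡∣p∣+∣q∣ (outside ∷ p) (inside  ∷ q) e =
  trans (cong suc (∣p∪q∣≡∣p∣+∣q∣ p q (drop-∷-Empty e))) (≡-sym (+-suc _ _))
∣p∪q∣≡∣p∣+∣q∣ (outside ∷ p) (outside ∷ q) e = ∣p∪q∣≡∣p∣+∣q∣ p q (drop-∷-Empty e)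

x∈⋂⇒All : ∀ {x} (ps : List (Subset n)) → x ∈ ⋂ ps → All (x ∈_) ps
x∈⋂⇒All []       _   = []
x∈⋂⇒All (p ∷ ps) x∈⋂ with x∈p∩q⁻ p (⋂ ps) x∈⋂
... | x∈p , x∈⋂ps = x∈p ∷ x∈⋂⇒All ps x∈⋂ps

All⊆⇒⋃⊆ : ∀ {q} (ps : List (Subset n)) → All (_⊆ q) ps → ⋃ ps ⊆ q
All⊆⇒⋃⊆ []       []             x∈⊥  = ⊥-elim (∉⊥ x∈⊥)
All⊆⇒⋃⊆ (p ∷ ps) (p⊆q ∷ ps⊆q) x∈⋃ = [ p⊆q , All⊆⇒⋃⊆ ps ps⊆q ] (x∈p∪q⁻ p (⋃ ps) x∈⋃)

⋂⊆⋃ : (p : Subset n) (ps : List (Subset n)) → ⋂ (p ∷ ps) ⊆ ⋃ (p ∷ ps)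
⋂⊆⋃ p ps = x∈p∪q⁺ ∘ inj₁ ∘ proj₁ ∘ x∈p∩q⁻ p (⋂ ps)

module _ {n : ℕ} (G : Graph n) where

  NoEdgeBetween : Subset n → Subset n → Set
  NoEdgeBetween I U = ∀ x y → x ∈ I → y ∈ U → ¬ Adj G x y

  stable⇒∁-cover : ∀ {S} → IsStable G S → IsVertexCover G (∁ S)
  stable⇒∁-cover {S} S-stable i j i~j with i ∈? S | j ∈? S
  ... | yes i∈S | yes j∈S = ⊥-elim (S-stable i j i∈S j∈S i~j)
  ... | no  i∉S | _       = inj₁ (x∉p⇒x∈∁p i∉S)
  ... | yes _   | no  j∉S = inj₂ (x∉p⇒x∈∁p j∉S)

  cover⇒∁-stable : ∀ {C} → IsVertexCover G C → IsStable G (∁ C)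
  cover⇒∁-stable C-cover i j i∈∁C j∈∁C i~j =
    [ x∈∁p⇒x∉p i∈∁C , x∈∁p⇒x∉p j∈∁C ] (C-cover i j i~j)

  maxStable⇒∁-minCover : ∀ {S} → IsMaxStable G S → IsMinCover G (∁ S)
  maxStable⇒∁-minCover {S} (S-stable , S-max) = stable⇒∁-cover S-stable , λ D D-cover → begin
    ∣ ∁ S ∣          ≡⟨ ∣∁p∣≡n∸∣p∣ S ⟩
    n ∸ ∣ S ∣        ≤⟨ ∸-monoʳ-≤ n (S-max (∁ D) (cover⇒∁-stable D-cover)) ⟩
    n ∸ ∣ ∁ D ∣      ≡⟨ cong (n ∸_) (∣∁p∣≡n∸∣p∣ D) ⟩
    n ∸ (n ∸ ∣ D ∣)  ≡⟨ m∸[m∸n]≡n (∣p∣≤n D) ⟩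
    ∣ D ∣            ∎
    where open ≤-Reasoning

  maxStable⊆∁τcore : ∀ {Kτ S} → IsTauCore G Kτ → IsMaxStable G S → S ⊆ ∁ Kτ
  maxStable⊆∁τcore {Kτ} {S} τcore S-max {i} i∈S = x∉p⇒x∈∁p λ i∈Kτ →
    x∈∁p⇒x∉p (Equivalence.to (τcore i) i∈Kτ (∁ S) (maxStable⇒∁-minCover S-max)) i∈S

  n≤τ+α : ∀ {a t} → IsAlpha G a → IsTau G t → n ≤ t + a
  n≤τ+α (_ , α-max) ((C , C-cover , refl) , _) = begin
    n                ≡⟨ ∣p∣+∣∁p∣≡n C ⟨
    ∣ C ∣ + ∣ ∁ C ∣  ≤⟨ +-monoʳ-≤ ∣ C ∣ (α-max (∁ C) (cover⇒∁-stable C-cover)) ⟩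
    ∣ C ∣ + _        ∎
    where open ≤-Reasoning

  exchange-stable : ∀ {I U T} → I ⊆ U → NoEdgeBetween I U →
                    IsStable G T → IsStable G ((I ∩ ∁ T) ∪ (T ∩ U))
  exchange-stable {I} {U} {T} I⊆U I≁U T-stable x y x∈ y∈ = no-edge (side x∈) (side y∈)
    where
    side : ∀ {z} → z ∈ (I ∩ ∁ T) ∪ (T ∩ U) → z ∈ I ⊎ (z ∈ T × z ∈ U)
    side z∈ = Sum.map (proj₁ ∘ x∈p∩q⁻ I (∁ T)) (x∈p∩q⁻ T U) (x∈p∪q⁻ (I ∩ ∁ T) (T ∩ U) z∈)
    no-edge : x ∈ I ⊎ (x ∈ T × x ∈ U) → y ∈ I ⊎ (y ∈ T × y ∈ U) → ¬ Adj G x y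
    no-edge (inj₁ x∈I)       (inj₁ y∈I)       = I≁U x y x∈I (I⊆U y∈I)
    no-edge (inj₁ x∈I)       (inj₂ (_ , y∈U)) = I≁U x y x∈I y∈U
    no-edge (inj₂ (_ , x∈U)) (inj₁ y∈I)       = I≁U y x y∈I x∈U ∘ Graph.sym G
    no-edge (inj₂ (x∈T , _)) (inj₂ (y∈T , _)) = T-stable x y x∈T y∈T

  ∣I∩∁T∣+∣T∩U∣≤∣T∣ : ∀ {I U T} → I ⊆ U → NoEdgeBetween I U →
                     IsMaxStable G T → ∣ I ∩ ∁ T ∣ + ∣ T ∩ U ∣ ≤ ∣ T ∣
  ∣I∩∁T∣+∣T∩U∣≤∣T∣ {I} {U} {T} I⊆U I≁U (T-stable , T-max) = begin
    ∣ I ∩ ∁ T ∣ + ∣ T ∩ U ∣        ≡⟨ ∣p∪q∣≡∣p∣+∣q∣ (I ∩ ∁ T) (T ∩ U) disjoint ⟨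
    ∣ (I ∩ ∁ T) ∪ (T ∩ U) ∣        ≤⟨ T-max _ (exchange-stable I⊆U I≁U T-stable) ⟩
    ∣ T ∣                          ∎
    where
    open ≤-Reasoning
    disjoint : Empty ((I ∩ ∁ T) ∩ (T ∩ U))
    disjoint (x , x∈) with x∈p∩q⁻ (I ∩ ∁ T) (T ∩ U) x∈
    ... | x∈I∩∁T , x∈T∩U = x∈∁p⇒x∉p (proj₂ (x∈p∩q⁻ I (∁ T) x∈I∩∁T)) (proj₁ (x∈p∩q⁻ T U x∈T∩U))

  ∣U∣+∣I∣≤∣T∪U∣+∣T∩I∣ : ∀ {I U T} → I ⊆ U → NoEdgeBetween I U →
                        IsMaxStable G T → ∣ U ∣ + ∣ I ∣ ≤ ∣ T ∪ U ∣ + ∣ T ∩ I ∣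
  ∣U∣+∣I∣≤∣T∪U∣+∣T∩I∣ {I} {U} {T} I⊆U I≁U T-max =
    subst₂ (λ i t∩i → ∣ U ∣ + i ≤ ∣ T ∪ U ∣ + t∩i)
      (∣p∩q∣+∣p∩∁q∣≡∣p∣ I T) (cong ∣_∣ (∩-comm I T))
      (rearrange {i₁ = ∣ I ∩ T ∣} (∣p∪q∣+∣p∩q∣≡∣p∣+∣q∣ T U) (∣I∩∁T∣+∣T∩U∣≤∣T∣ I⊆U I≁U T-max))
    where
    rearrange : ∀ {u i₁ i₂ c t w} → w + c ≡ t + u → i₂ + c ≤ t → u + (i₁ + i₂) ≤ w + i₁
    rearrange {u} {i₁} {i₂} {c} {t} {w} w+c≡t+u i₂+c≤t = +-cancelʳ-≤ c _ _ (begin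
      u + (i₁ + i₂) + c   ≡⟨ cong (_+ c) (+-assoc u i₁ i₂) ⟨
      u + i₁ + i₂ + c     ≡⟨ +-assoc (u + i₁) i₂ c ⟩
      u + i₁ + (i₂ + c)   ≤⟨ +-monoʳ-≤ (u + i₁) i₂+c≤t ⟩
      u + i₁ + t          ≡⟨ xy∙z≈zx∙y u i₁ t ⟩
      t + u + i₁          ≡⟨ cong (_+ i₁) w+c≡t+u ⟨
      w + c + i₁          ≡⟨ xy∙z≈xz∙y w c i₁ ⟩
      w + i₁ + c          ∎)
      where open ≤-Reasoning

  ⋂-⋃-edgeless : ∀ Ss → All (IsStable G) Ss → NoEdgeBetween (⋂ Ss) (⋃ Ss)
  ⋂-⋃-edgeless []       []                x y _   y∈⊥ = ⊥-elim (∉⊥ y∈⊥)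
  ⋂-⋃-edgeless (S ∷ Ss) (S-stable ∷ Ss-stable) x y x∈⋂ y∈⋃
    with x∈p∩q⁻ S (⋂ Ss) x∈⋂ | x∈p∪q⁻ S (⋃ Ss) y∈⋃
  ... | x∈S , _     | inj₁ y∈S  = S-stable x y x∈S y∈S
  ... | _   , x∈⋂Ss | inj₂ y∈⋃Ss = ⋂-⋃-edgeless Ss Ss-stable x y x∈⋂Ss y∈⋃Ss

  ∣S∣+∣S∣≤∣⋃∣+∣⋂∣ : ∀ S Ss → All (IsMaxStable G) (S ∷ Ss) →
                    ∣ S ∣ + ∣ S ∣ ≤ ∣ ⋃ (S ∷ Ss) ∣ + ∣ ⋂ (S ∷ Ss) ∣
  ∣S∣+∣S∣≤∣⋃∣+∣⋂∣ S [] _ =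
    ≤-reflexive (≡-sym (cong₂ _+_ (cong ∣_∣ (∪-identityʳ S)) (cong ∣_∣ (∩-identityʳ S))))
  ∣S∣+∣S∣≤∣⋃∣+∣⋂∣ T (S ∷ Ss) (T-max ∷ S∷Ss-max@(S-max ∷ _)) = begin
    ∣ T ∣ + ∣ T ∣                          ≤⟨ +-mono-≤ ∣T∣≤∣S∣ ∣T∣≤∣S∣ ⟩
    ∣ S ∣ + ∣ S ∣                          ≤⟨ ∣S∣+∣S∣≤∣⋃∣+∣⋂∣ S Ss S∷Ss-max ⟩
    ∣ ⋃ (S ∷ Ss) ∣ + ∣ ⋂ (S ∷ Ss) ∣        ≤⟨ ∣U∣+∣I∣≤∣T∪U∣+∣T∩I∣ (⋂⊆⋃ S Ss) ⋂≁⋃ T-max ⟩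
    ∣ T ∪ ⋃ (S ∷ Ss) ∣ + ∣ T ∩ ⋂ (S ∷ Ss) ∣ ∎
    where
    open ≤-Reasoning
    ∣T∣≤∣S∣ : ∣ T ∣ ≤ ∣ S ∣
    ∣T∣≤∣S∣ = proj₂ S-max T (proj₁ T-max)
    ⋂≁⋃ : NoEdgeBetween (⋂ (S ∷ Ss)) (⋃ (S ∷ Ss))
    ⋂≁⋃ = ⋂-⋃-edgeless (S ∷ Ss) (All.map proj₁ S∷Ss-max)

  ¬¬-⋂maxStable⊆αcore : ∀ {Kα S₀} → IsAlphaCore G Kα → IsMaxStable G S₀ →
    ¬ ¬ (Σ[ Ss ∈ List (Subset n) ] All (IsMaxStable G) Ss × ⋂ (S₀ ∷ Ss) ⊆ Kα)
  ¬¬-⋂maxStable⊆αcore {Kα} {S₀} αcore S₀-max = ¬¬-map family (¬¬-Π-Fin n inCore-or-missed)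
    where
    InCoreOrMissedBy : Fin n → Subset n → Set
    InCoreOrMissedBy i S = IsMaxStable G S × (i ∈ Kα ⊎ i ∉ S)

    inCore-or-missed : ∀ i → ¬ ¬ (Σ[ S ∈ Subset n ] InCoreOrMissedBy i S)
    inCore-or-missed i ¬witness = ¬witness (S₀ , S₀-max , inj₁ (Equivalence.from (αcore i)
      λ S S-max → decidable-stable (i ∈? S) λ i∉S → ¬witness (S , S-max , inj₂ i∉S)))

    family : (∀ i → Σ[ S ∈ Subset n ] InCoreOrMissedBy i S) →
             Σ[ Ss ∈ List (Subset n) ] All (IsMaxStable G) Ss × ⋂ (S₀ ∷ Ss) ⊆ Kα
    family w = tabulate (proj₁ ∘ w) , All.tabulate⁺ (proj₁ ∘ proj₂ ∘ w) , ⋂⊆Kα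
      where
      ⋂⊆Kα : ⋂ (S₀ ∷ tabulate (proj₁ ∘ w)) ⊆ Kα
      ⋂⊆Kα {i} i∈⋂ = [ id , (λ i∉Sᵢ → ⊥-elim (i∉Sᵢ i∈Sᵢ)) ] (proj₂ (proj₂ (w i)))
        where
        i∈Sᵢ : i ∈ proj₁ (w i)
        i∈Sᵢ = All.tabulate⁻ (x∈⋂⇒All _ (proj₂ (x∈p∩q⁻ S₀ _ i∈⋂))) i

  2α≤∣∁τcore∣+∣αcore∣ : ∀ {Kα Kτ S₀} → IsMaxStable G S₀ → IsAlphaCore G Kα → IsTauCore G Kτ →
                        ∣ S₀ ∣ + ∣ S₀ ∣ ≤ ∣ ∁ Kτ ∣ + ∣ Kα ∣
  2α≤∣∁τcore∣+∣αcore∣ {Kα} {Kτ} {S₀} S₀-max αcore τcore =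
    decidable-stable (_ ≤? _) (¬¬-map bound (¬¬-⋂maxStable⊆αcore αcore S₀-max))
    where
    bound : Σ[ Ss ∈ List (Subset n) ] All (IsMaxStable G) Ss × ⋂ (S₀ ∷ Ss) ⊆ Kα →
            ∣ S₀ ∣ + ∣ S₀ ∣ ≤ ∣ ∁ Kτ ∣ + ∣ Kα ∣
    bound (Ss , Ss-max , ⋂⊆Kα) = ≤-trans (∣S∣+∣S∣≤∣⋃∣+∣⋂∣ S₀ Ss (S₀-max ∷ Ss-max))
      (+-mono-≤ (p⊆q⇒∣p∣≤∣q∣ (All⊆⇒⋃⊆ (S₀ ∷ Ss) (All.map (maxStable⊆∁τcore τcore) (S₀-max ∷ Ss-max))))
                (p⊆q⇒∣p∣≤∣q∣ ⋂⊆Kα))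

corollary2p6 : ∀ {n} (G : Graph n) (a t : ℕ) (Kα Kτ : Subset n) →
    IsAlpha G a → IsTau G t → IsAlphaCore G Kα → IsTauCore G Kτ →
    a ∸ ∣ Kα ∣ ≤ t ∸ ∣ Kτ ∣
corollary2p6 {n} G a t Kα Kτ α@((S₀ , S₀-stable , refl) , α-max) τ αcore τcore =
  m+n≤o+p⇒m∸p≤o∸n a (∣ Kτ ∣) t (∣ Kα ∣) (+-cancelˡ-≤ a _ _ (begin
    a + (a + ∣ Kτ ∣)            ≡⟨ +-assoc a a ∣ Kτ ∣ ⟨
    a + a + ∣ Kτ ∣              ≤⟨ +-monoˡ-≤ ∣ Kτ ∣ (2α≤∣∁τcore∣+∣αcore∣ G (S₀-stable , α-max) αcore τcore) ⟩
    ∣ ∁ Kτ ∣ + ∣ Kα ∣ + ∣ Kτ ∣   ≡⟨ xy∙z≈zx∙y (∣ ∁ Kτ ∣) (∣ Kα ∣) (∣ Kτ ∣) ⟩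
    ∣ Kτ ∣ + ∣ ∁ Kτ ∣ + ∣ Kα ∣   ≡⟨ cong (_+ ∣ Kα ∣) (∣p∣+∣∁p∣≡n Kτ) ⟩
    n + ∣ Kα ∣                  ≤⟨ +-monoˡ-≤ ∣ Kα ∣ (n≤τ+α G α τ) ⟩
    t + a + ∣ Kα ∣              ≡⟨ xy∙z≈y∙xz t a (∣ Kα ∣) ⟩
    a + (t + ∣ Kα ∣)            ∎))
  where open ≤-Reasoning
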